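{- Let $p$ be a prime, $D$ a discriminant form of level $p^l$ and even signature, and $\gamma\in D$. Suppose that $\gamma^{\perp}$ contains an isotropic subgroup $H$ isomorphic to $(\mathbb Z/p\mathbb Z)^2$. Then $e^{\gamma}$ is a linear combination of isotropic lifts, i.e. of elements $\uparrow_K^D(w)$ with $K$ a non-trivial isotropic subgroup of $D$ and $w\in\mathbb C[K^\perp/K]$.
   Context: A discriminant form is a finite abelian group $D$ with a quadratic form $\operatorname{q}:D\to\mathbb Q/\mathbb Z$ whose bilinear form $(\beta,\gamma)=\operatorname{q}(\beta+\gamma)-\operatorname{q}(\beta)-\operatorname{q}(\gamma)$ is nondegenerate; level = least $N>0$ with $N\operatorname{q}\equiv0$; signature $\operatorname{sign}(D)\in\mathbb Z/8\mathbb Z$. $\gamma^\perp=\{\mu:(\mu,\gamma)=0\}$. A subgroup $K$ is isotropic if $\operatorname{q}|_K=0$; then $K^\perp/K$ is a discriminant form, and the isotropic lift $\uparrow_K^D:\mathbb C[K^\perp/K]\to\mathbb C[D]$ is the linear map $e^{\beta+K}\mapsto\sum_{\mu\in K}e^{\beta+\mu}$ ($\beta\in K^\perp$). -}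

module Defs where

open import Level using (0ℓ)
open import Data.Bool using (Bool; true; false; if_then_else_)
open import Data.Nat as ℕ using (ℕ; zero; suc; NonZero; _<_; _≤_)
import Data.Nat.Divisibility as ℕD
open import Data.Integer as ℤ using (ℤ; +_; ∣_∣; _%ℕ_)
open import Data.Fin using (Fin; toℕ)
open import Data.Fin.Properties using (all?)
open import Data.Product using (Σ; ∃; ∃-syntax; _×_; _,_)
open import Data.List using (List; []; _∷_)
open import Relation.Nullary using (Dec; ¬_)
open import Relation.Nullary.Decidable using (⌊_⌋; _→-dec_)
open import Relation.Binary.PropositionalEquality using (_≡_; _≢_)
open import Algebra.Bundles using (CommutativeRing)
open import Function.Bundles using (_⇔_)
import Data.Bool.Properties as BoolP

-- Congruence of integers modulo a natural number M.
-- An element of Q/Z of the form a/M is represented by a : ℤ, and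
-- a/M ≡ b/M in Q/Z  iff  a ≡ b [mod M].

_≡_[mod_] : ℤ → ℤ → ℕ → Set
a ≡ b [mod M ] = M ℕD.∣ ∣ a ℤ.- b ∣

infix 4 _≡_[mod_]

-- The quadratic form q : D → Q/Z is given by q(x) = Q x / M  (mod Z)
-- for a fixed positive integer M (every finite quadratic form takes
-- values in (1/M)Z/Z for some M, e.g. M = level).

mulℕ : {A : Set} → (A → A → A) → A → ℕ → A → A
mulℕ _⊕_ 0ᴰ zero    x = 0ᴰ
mulℕ _⊕_ 0ᴰ (suc k) x = x ⊕ mulℕ _⊕_ 0ᴰ k x

bil : {A : Set} → (A → A → A) → (A → ℤ) → A → A → ℤ
bil _⊕_ Q x y = Q (x ⊕ y) ℤ.- Q x ℤ.- Q y

record DiscForm : Set where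
  field
    n     : ℕ
    _⊕_   : Fin n → Fin n → Fin n
    0ᴰ    : Fin n
    ⊖_    : Fin n → Fin n
    ⊕-assoc : ∀ x y z → (x ⊕ y) ⊕ z ≡ x ⊕ (y ⊕ z)
    ⊕-comm  : ∀ x y → x ⊕ y ≡ y ⊕ x
    ⊕-idˡ   : ∀ x → 0ᴰ ⊕ x ≡ x
    ⊕-invˡ  : ∀ x → (⊖ x) ⊕ x ≡ 0ᴰ
    M     : ℕ
    .{{M-nonzero}} : NonZero M
    Q     : Fin n → ℤ


    Q-scale : ∀ (k : ℕ) x → Q (mulℕ _⊕_ 0ᴰ k x) ≡ (+ k) ℤ.* (+ k) ℤ.* Q x [mod M ]
    Q-neg   : ∀ x → Q (⊖ x) ≡ Q x [mod M ]
    B-additiveˡ : ∀ x y z → bil _⊕_ Q (x ⊕ y) z ≡ bil _⊕_ Q x z ℤ.+ bil _⊕_ Q y z [mod M ]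
    B-nondeg : ∀ x → (∀ y → bil _⊕_ Q x y ≡ + 0 [mod M ]) → x ≡ 0ᴰ

  _·_ : ℕ → Fin n → Fin n
  _·_ = mulℕ _⊕_ 0ᴰ

  B : Fin n → Fin n → ℤ
  B = bil _⊕_ Q

module RingBasics (F : CommutativeRing 0ℓ 0ℓ) where
  open CommutativeRing F renaming (Carrier to C)

  pow : C → ℕ → C
  pow z zero    = 1#
  pow z (suc k) = z * pow z k

  fromℕ : ℕ → C
  fromℕ zero    = 0#
  fromℕ (suc k) = 1# + fromℕ k

  sumFin : ∀ {k} → (Fin k → C) → C
  sumFin {zero}  f = 0#
  sumFin {suc k} f = f Fin.zero + sumFin (λ i → f (Fin.suc i))
    where import Data.Fin as Fin

  IsFieldChar0 : Set
  IsFieldChar0 = (¬ (1# ≈ 0#))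
               × (∀ x → ¬ (x ≈ 0#) → ∃[ y ] (x * y ≈ 1#))
               × (∀ k → ¬ (fromℕ (suc k) ≈ 0#))


open RingBasics public using (IsFieldChar0)

module _ (D : DiscForm) where
  open DiscForm D

  IsLevel : ℕ → Set
  IsLevel N = (0 < N)
            × (∀ x → (+ N) ℤ.* Q x ≡ + 0 [mod M ])
            × (∀ N′ → 0 < N′ → (∀ x → (+ N′) ℤ.* Q x ≡ + 0 [mod M ]) → N ≤ N′)

  Subset : Set
  Subset = Fin n → Bool

  _∈_ : Fin n → Subset → Set
  x ∈ K = K x ≡ true

  IsSubgroup : Subset → Set
  IsSubgroup K = (0ᴰ ∈ K) × (∀ x y → x ∈ K → y ∈ K → (x ⊕ y) ∈ K)
               × (∀ x → x ∈ K → (⊖ x) ∈ K)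

  IsIsotropic : Subset → Set
  IsIsotropic K = ∀ x → x ∈ K → Q x ≡ + 0 [mod M ]

  NonTrivial : Subset → Set
  NonTrivial K = ∃[ x ] (x ∈ K × x ≢ 0ᴰ)

  Orth : Fin n → Fin n → Set
  Orth μ γ = B μ γ ≡ + 0 [mod M ]

  InPerp : Subset → Fin n → Set
  InPerp K δ = ∀ κ → κ ∈ K → Orth δ κ

  inPerp? : (K : Subset) → (δ : Fin n) → Dec (InPerp K δ)
  inPerp? K δ = all? (λ κ → (K κ BoolP.≟ true) →-dec (M ℕD.∣? ∣ B δ κ ℤ.- + 0 ∣))

  -- H ≅ (Z/pZ)² : there are a, b with p a = p b = 0 such that
  -- (i , j) ↦ i a + j b is a bijection  (Z/pZ)² → H  (a group isomorphism,
  -- since p a = p b = 0).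
  IsoZp² : ℕ → Subset → Set
  IsoZp² p H = Σ (Fin n) λ a → Σ (Fin n) λ b →
      (p · a ≡ 0ᴰ) × (p · b ≡ 0ᴰ)
    × (∀ h → h ∈ H ⇔ (∃[ i ] ∃[ j ] (h ≡ (toℕ {p} i · a) ⊕ (toℕ {p} j · b))))
    × (∀ (i j i′ j′ : Fin p) →
         (toℕ i · a) ⊕ (toℕ j · b) ≡ (toℕ i′ · a) ⊕ (toℕ j′ · b) → (i ≡ i′ × j ≡ j′))

  module _ (F : CommutativeRing 0ℓ 0ℓ) where
    open CommutativeRing F renaming (Carrier to C)
    open RingBasics F

    IsPrimitiveRoot : C → Set
    IsPrimitiveRoot ζ = (pow ζ M ≈ 1#) × (∀ k → 0 < k → k < M → ¬ (pow ζ k ≈ 1#))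

    -- e(q(x)) = ζ^{M q(x)}, with ζ = e(1/M)
    e-q : C → Fin n → C
    e-q ζ x = pow ζ (Q x %ℕ M)

    -- Gauss sum  G = Σ_{x ∈ D} e(q(x)) = √|D| e(sign(D)/8)  (Milgram)
    Gauss : C → C
    Gauss ζ = sumFin (e-q ζ)

    -- sign(D) is even  iff  e(sign(D)/4) = ±1  iff  G² = ±|D|
    EvenSignature : C → Set
    EvenSignature ζ = (Gauss ζ * Gauss ζ ≈ fromℕ n) ⊎′ (Gauss ζ * Gauss ζ ≈ - fromℕ n)
      where open import Data.Sum using () renaming (_⊎_ to _⊎′_)

    -- The group ring F[D] is modelled as functions D → F.
    -- Standard basis vector e^γ.
    basis : Fin n → Fin n → C
    basis γ δ = if ⌊ γ Data.Fin.≟ δ ⌋ then 1# else 0#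
      where import Data.Fin

    -- An element of F[K^⊥/K]: a function on K^⊥ constant on cosets of K
    -- (its values outside K^⊥ are irrelevant).
    record CosetFn (K : Subset) : Set where
      field
        w   : Fin n → C
        inv : ∀ β κ → InPerp K β → κ ∈ K → w (β ⊕ κ) ≈ w β

    -- isotropic lift ↑_K^D : F[K^⊥/K] → F[D],
    -- e^{β+K} ↦ Σ_{μ∈K} e^{β+μ};  so (↑ w)(δ) = w(δ+K) if δ ∈ K^⊥, else 0.
    lift : (K : Subset) → CosetFn K → Fin n → C
    lift K w δ = if ⌊ inPerp? K δ ⌋ then CosetFn.w w δ else 0#

    record LiftTerm : Set where
      field
        K      : Subset
        K-sub  : IsSubgroup K
        K-iso  : IsIsotropic K
        K-nt   : NonTrivial K
        coeff  : C
        vec    : CosetFn K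

    sumList : List LiftTerm → Fin n → C
    sumList []       δ = 0#
    sumList (t ∷ ts) δ = (LiftTerm.coeff t * lift (LiftTerm.K t) (LiftTerm.vec t) δ) + sumList ts δ

    InLiftSpan : (Fin n → C) → Set
    InLiftSpan v = ∃[ ts ] (∀ δ → v δ ≈ sumList ts δ)

-- Let a, b be a basis of the plane H ≅ (ℤ/p)² ⊆ γ^⊥. Every subgroup K ⊆ H is isotropic and γ ∈ K^⊥,
-- so γ + K ⊆ K^⊥ and the lift of e^{γ+K} is the indicator function of the coset γ + K. The p + 1 lines
-- ⟨b⟩, ⟨a + t b⟩ (t < p) of H cover every non-zero element of H exactly once and 0 exactly p + 1 times,
-- so  Σ_L 1_{γ+L} − 1_{γ+H} = p e^γ,  and e^γ is this combination of lifts divided by p ≠ 0.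
{-# OPTIONS --safe #-}
module Submission where

open import Defs
open import Level using (0ℓ)
open import Data.Bool using (Bool; true; false; if_then_else_)
import Data.Bool.Properties as Bool
open import Data.Nat as ℕ using (ℕ; zero; suc; 2+; NonZero; _<_; _≤_; _∸_; _^_)
import Data.Nat.Properties as ℕ
open import Data.Nat.DivMod using (_%_; _/_; _mod_; m≡m%n+[m/n]*n; m%n<n; m<n⇒m%n≡m)
open import Data.Nat.Divisibility using (divides; n∣m⇒m%n≡0) renaming (_∣_ to _∣ℕ_)
open import Data.Nat.Coprimality using (coprime-divisor; prime⇒coprime)
open import Data.Nat.Primality using (Prime; ¬prime[0]; ¬prime[1])
open import Data.Integer as ℤ using (+_)
import Data.Integer.Properties as ℤ
open import Data.Integer.Divisibility.Signed
  using (_∣_; ∣ᵤ⇒∣; ∣⇒∣ᵤ; ∣m∣n⇒∣m+n; ∣m∣n⇒∣m-n; ∣m+n∣n⇒∣m; ∣m⇒∣-m)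
open import Data.Fin as Fin using (Fin; toℕ; punchOut)
import Data.Fin.Properties as Fin
open import Data.List using (List; []; _∷_; _++_; tabulate)
open import Data.Product using (Σ-syntax; ∃-syntax; _×_; _,_; proj₁; proj₂; uncurry)
open import Algebra.Bundles using (AbelianGroup; CommutativeRing)
import Algebra.Properties.AbelianGroup as AbelianGroupProperties
import Algebra.Properties.CommutativeMonoid.Mult as MultProperties
import Algebra.Properties.CommutativeSemigroup as CommutativeSemigroupProperties
import Algebra.Properties.Ring as RingProperties
open import Function using (_∘_; id)
open import Function.Bundles using (Equivalence; _⇔_)
open import Function.Definitions using (Injective)
open import Relation.Nullary using (¬_; yes; no; contradiction)
open import Relation.Nullary.Decidable using (⌊_⌋; toWitness; fromWitness)
open import Relation.Binary.PropositionalEquality as ≡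
  using (_≡_; _≢_; refl; sym; trans; cong; cong₂; subst; isEquivalence; module ≡-Reasoning)
import Relation.Binary.Reasoning.Setoid as SetoidReasoning

%≡%⇒∣∸ : ∀ m n d .{{_ : NonZero d}} → m % d ≡ n % d → d ∣ℕ n ∸ m
%≡%⇒∣∸ m n d eq = divides (n / d ∸ m / d) (begin
  n ∸ m
    ≡⟨ cong₂ _∸_ (m≡m%n+[m/n]*n n d) (m≡m%n+[m/n]*n m d) ⟩
  (n % d ℕ.+ n / d ℕ.* d) ∸ (m % d ℕ.+ m / d ℕ.* d)
    ≡⟨ cong (λ r → (r ℕ.+ n / d ℕ.* d) ∸ (m % d ℕ.+ m / d ℕ.* d)) (sym eq) ⟩
  (m % d ℕ.+ n / d ℕ.* d) ∸ (m % d ℕ.+ m / d ℕ.* d)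
    ≡⟨ ℕ.[m+n]∸[m+o]≡n∸o (m % d) (n / d ℕ.* d) (m / d ℕ.* d) ⟩
  n / d ℕ.* d ∸ m / d ℕ.* d
    ≡⟨ ℕ.*-distribʳ-∸ d (n / d) (m / d) ⟨
  (n / d ∸ m / d) ℕ.* d
    ∎)
  where open ≡-Reasoning

*-%-cancelˡ-≤ : ∀ {p u t t′} .{{_ : NonZero p}} .{{_ : NonZero u}} → Prime p → u < p → t′ < p →
                (u ℕ.* t) % p ≡ (u ℕ.* t′) % p → t′ ≤ t
*-%-cancelˡ-≤ {p} {u} {t} {t′} p-prime u<p t′<p eq = ℕ.m∸n≡0⇒m≤n (begin
  t′ ∸ t       ≡⟨ m<n⇒m%n≡m (ℕ.≤-<-trans (ℕ.m∸n≤m t′ t) t′<p) ⟨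
  (t′ ∸ t) % p ≡⟨ n∣m⇒m%n≡0 (t′ ∸ t) p p∣t′∸t ⟩
  0            ∎)
  where
  open ≡-Reasoning
  p∣t′∸t : p ∣ℕ t′ ∸ t
  p∣t′∸t = coprime-divisor (prime⇒coprime p-prime u<p)
             (subst (p ∣ℕ_) (sym (ℕ.*-distribˡ-∸ u t′ t)) (%≡%⇒∣∸ (u ℕ.* t) (u ℕ.* t′) p eq))

infixl 7 _*ₘ_

_*ₘ_ : ∀ {p} .{{_ : NonZero p}} → Fin p → Fin p → Fin p
_*ₘ_ {p} u t = (toℕ u ℕ.* toℕ t) mod p

toℕ-*ₘ : ∀ {p} .{{_ : NonZero p}} (u t : Fin p) → toℕ (u *ₘ t) ≡ (toℕ u ℕ.* toℕ t) % p
toℕ-*ₘ u t = Fin.toℕ-fromℕ< _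

*ₘ-cancelˡ : ∀ {p} .{{_ : NonZero p}} → Prime p → ∀ {u} → toℕ u ≢ 0 → Injective _≡_ _≡_ (u *ₘ_)
*ₘ-cancelˡ {p} p-prime {u} u≢0 {t} {t′} eq = Fin.toℕ-injective
  (ℕ.≤-antisym (*-%-cancelˡ-≤ p-prime (Fin.toℕ<n u) (Fin.toℕ<n t) (sym eq%))
               (*-%-cancelˡ-≤ p-prime (Fin.toℕ<n u) (Fin.toℕ<n t′) eq%))
  where
  instance
    u-nonZero : NonZero (toℕ u)
    u-nonZero = ℕ.≢-nonZero u≢0
  eq% : (toℕ u ℕ.* toℕ t) % p ≡ (toℕ u ℕ.* toℕ t′) % p
  eq% = trans (sym (toℕ-*ₘ u t)) (trans (cong toℕ eq) (toℕ-*ₘ u t′))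

injective⇒surjective : ∀ {n} {f : Fin n → Fin n} → Injective _≡_ _≡_ f → ∀ y → ∃[ x ] f x ≡ y
injective⇒surjective {suc n} {f} f-inj y with Fin.any? (λ x → f x Fin.≟ y)
... | yes found = found
... | no ¬found =
  let i , j , i<j , fi≡fj = Fin.pigeonhole (ℕ.n<1+n n) (λ x → punchOut (avoids x))
  in contradiction (f-inj (Fin.punchOut-injective (avoids i) (avoids j) fi≡fj)) (Fin.<⇒≢ i<j)
  where
  avoids : ∀ x → y ≢ f x
  avoids x y≡fx = ¬found (x , sym y≡fx)

true⇔true⇒≡ : ∀ {x y : Bool} → (x ≡ true → y ≡ true) → (y ≡ true → x ≡ true) → x ≡ y
true⇔true⇒≡ {false} {false} _ _ = refl
true⇔true⇒≡ {false} {true}  _   y⇒x = y⇒x refl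
true⇔true⇒≡ {true}  {_}     x⇒y _   = sym (x⇒y refl)

module _ (R : CommutativeRing 0ℓ 0ℓ) where
  open CommutativeRing R renaming (refl to ≈-refl; sym to ≈-sym; trans to ≈-trans)
  open RingProperties ring using (-‿distribˡ-*; xyx⁻¹≈y)
  open SetoidReasoning setoid

  x[y+zw]+[-x]y≈w : ∀ {x z} → x * z ≈ 1# → ∀ y w → x * (y + z * w) + (- x) * y ≈ w
  x[y+zw]+[-x]y≈w {x} {z} xz≈1 y w = begin
    x * (y + z * w) + (- x) * y        ≈⟨ +-cong (distribˡ x y (z * w)) (≈-sym (-‿distribˡ-* x y)) ⟩
    x * y + x * (z * w) + - (x * y)    ≈⟨ xyx⁻¹≈y (x * y) (x * (z * w)) ⟩
    x * (z * w)                        ≈⟨ ≈-sym (*-assoc x z w) ⟩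
    (x * z) * w                        ≈⟨ *-congʳ xz≈1 ⟩
    1# * w                             ≈⟨ *-identityˡ w ⟩
    w                                  ∎

module DiscFormGroup (D : DiscForm) where
  open DiscForm D

  abelianGroup : AbelianGroup 0ℓ 0ℓ
  abelianGroup = record
    { Carrier = Fin n ; _≈_ = _≡_ ; _∙_ = _⊕_ ; ε = 0ᴰ ; _⁻¹ = ⊖_
    ; isAbelianGroup = record
      { isGroup = record
        { isMonoid = record
          { isSemigroup = record
            { isMagma = record { isEquivalence = isEquivalence ; ∙-cong = cong₂ _⊕_ }
            ; assoc = ⊕-assoc }
          ; identity = ⊕-idˡ , λ x → trans (⊕-comm x 0ᴰ) (⊕-idˡ x) }
        ; inverse = ⊕-invˡ , λ x → trans (⊕-comm x (⊖ x)) (⊕-invˡ x)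
        ; ⁻¹-cong = cong ⊖_ }
      ; comm = ⊕-comm } }

  open AbelianGroup abelianGroup public using (identityʳ; commutativeMonoid; commutativeSemigroup)
  open AbelianGroupProperties abelianGroup public
    using (inverseˡ-unique; //-rightDividesˡ; //-rightDividesʳ; x≈y⇒x∙y⁻¹≈ε; x∙y⁻¹≈ε⇒x≈y)
  open CommutativeSemigroupProperties commutativeSemigroup public using (xy∙z≈xz∙y)
  open MultProperties commutativeMonoid using (×-homo-+; ×-assocˡ; ×-distrib-+) renaming (_×_ to _×ᴰ_)

  ·≗× : ∀ k x → k · x ≡ k ×ᴰ x
  ·≗× zero    x = refl
  ·≗× (suc k) x = cong (x ⊕_) (·≗× k x)

  ·-homo-+ : ∀ x m n → (m ℕ.+ n) · x ≡ (m · x) ⊕ (n · x)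
  ·-homo-+ x m n rewrite ·≗× (m ℕ.+ n) x | ·≗× m x | ·≗× n x = ×-homo-+ x m n

  ·-assocˡ : ∀ x m n → m · (n · x) ≡ (m ℕ.* n) · x
  ·-assocˡ x m n rewrite ·≗× n x | ·≗× m (n ×ᴰ x) | ·≗× (m ℕ.* n) x = ×-assocˡ x m n

  ·-distrib-⊕ : ∀ x y m → m · (x ⊕ y) ≡ (m · x) ⊕ (m · y)
  ·-distrib-⊕ x y m rewrite ·≗× m (x ⊕ y) | ·≗× m x | ·≗× m y = ×-distrib-+ x y m

  ·-zeroʳ : ∀ m → m · 0ᴰ ≡ 0ᴰ
  ·-zeroʳ zero    = refl
  ·-zeroʳ (suc m) = trans (⊕-idˡ (m · 0ᴰ)) (·-zeroʳ m)

  module _ {p : ℕ} .{{_ : NonZero p}} where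

    ·-mod : ∀ {x} → p · x ≡ 0ᴰ → ∀ m → m · x ≡ toℕ (m mod p) · x
    ·-mod {x} px≡0 m = begin
      m · x                                    ≡⟨ cong (_· x) (m≡m%n+[m/n]*n m p) ⟩
      (m % p ℕ.+ m / p ℕ.* p) · x              ≡⟨ ·-homo-+ x (m % p) (m / p ℕ.* p) ⟩
      ((m % p) · x) ⊕ ((m / p ℕ.* p) · x)      ≡⟨ cong (((m % p) · x) ⊕_) (sym (·-assocˡ x (m / p) p)) ⟩
      ((m % p) · x) ⊕ ((m / p) · (p · x))      ≡⟨ cong (λ y → ((m % p) · x) ⊕ ((m / p) · y)) px≡0 ⟩
      ((m % p) · x) ⊕ ((m / p) · 0ᴰ)           ≡⟨ cong (((m % p) · x) ⊕_) (·-zeroʳ (m / p)) ⟩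
      ((m % p) · x) ⊕ 0ᴰ                       ≡⟨ identityʳ _ ⟩
      (m % p) · x                              ≡⟨ cong (_· x) (Fin.toℕ-fromℕ< (m%n<n m p)) ⟨
      toℕ (m mod p) · x                        ∎
      where open ≡-Reasoning

    cyclic : Fin n → Subset D
    cyclic g x = ⌊ Fin.any? (λ (k : Fin p) → (toℕ k · g) Fin.≟ x) ⌋

    ∈cyclic⇒ : ∀ {g x} → _∈_ D x (cyclic g) → ∃[ k ] toℕ {p} k · g ≡ x
    ∈cyclic⇒ x∈ = toWitness (Equivalence.from Bool.T-≡ x∈)

    toℕ·∈cyclic : ∀ g (k : Fin p) → _∈_ D (toℕ k · g) (cyclic g)
    toℕ·∈cyclic g k = Equivalence.to Bool.T-≡ (fromWitness (k , refl))

    ·∈cyclic : ∀ {g} → p · g ≡ 0ᴰ → ∀ m → _∈_ D (m · g) (cyclic g)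
    ·∈cyclic pg≡0 m = subst (λ y → _∈_ D y (cyclic _)) (sym (·-mod pg≡0 m)) (toℕ·∈cyclic _ (m mod p))

    cyclic-isSubgroup : ∀ {g} → p · g ≡ 0ᴰ → IsSubgroup D (cyclic g)
    cyclic-isSubgroup {g} pg≡0 = ·∈cyclic pg≡0 0 , ⊕-closed , ⊖-closed
      where
      ⊕-closed : ∀ x y → _∈_ D x (cyclic g) → _∈_ D y (cyclic g) → _∈_ D (x ⊕ y) (cyclic g)
      ⊕-closed x y x∈ y∈ with i , refl ← ∈cyclic⇒ x∈ | j , refl ← ∈cyclic⇒ y∈ =
        subst (λ z → _∈_ D z (cyclic g)) (·-homo-+ g (toℕ i) (toℕ j)) (·∈cyclic pg≡0 (toℕ i ℕ.+ toℕ j))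
      ⊖-closed : ∀ x → _∈_ D x (cyclic g) → _∈_ D (⊖ x) (cyclic g)
      ⊖-closed x x∈ with i , refl ← ∈cyclic⇒ x∈ =
        subst (λ z → _∈_ D z (cyclic g)) (inverseˡ-unique _ _ sum≡0) (·∈cyclic pg≡0 (p ℕ.∸ toℕ i))
        where
        sum≡0 : ((p ℕ.∸ toℕ i) · g) ⊕ (toℕ i · g) ≡ 0ᴰ
        sum≡0 = trans (sym (·-homo-+ g (p ℕ.∸ toℕ i) (toℕ i)))
                      (trans (cong (_· g) (ℕ.m∸n+n≡m (ℕ.<⇒≤ (Fin.toℕ<n i)))) pg≡0)

    generator∈cyclic : ∀ {g} → p · g ≡ 0ᴰ → _∈_ D g (cyclic g)
    generator∈cyclic {g} pg≡0 = subst (λ z → _∈_ D z (cyclic g)) (identityʳ g) (·∈cyclic pg≡0 1)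

  ∈-⊕-invariant : ∀ {K} → IsSubgroup D K → ∀ y {κ} → _∈_ D κ K → K (y ⊕ κ) ≡ K y
  ∈-⊕-invariant {K} (_ , ⊕-closed , ⊖-closed) y {κ} κ∈K = true⇔true⇒≡
    (λ yκ∈K → subst (λ z → _∈_ D z K) (//-rightDividesʳ κ y) (⊕-closed _ _ yκ∈K (⊖-closed κ κ∈K)))
    (λ y∈K → ⊕-closed y κ y∈K κ∈K)

  ·-comm : ∀ x m n → m · (n · x) ≡ n · (m · x)
  ·-comm x m n = begin
    m · (n · x)    ≡⟨ ·-assocˡ x m n ⟩
    (m ℕ.* n) · x  ≡⟨ cong (_· x) (ℕ.*-comm m n) ⟩
    (n ℕ.* m) · x  ≡⟨ ·-assocˡ x n m ⟨
    n · (m · x)    ∎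
    where open ≡-Reasoning

  ≟-diff : ∀ γ δ → ⌊ γ Fin.≟ δ ⌋ ≡ ⌊ (δ ⊕ (⊖ γ)) Fin.≟ 0ᴰ ⌋
  ≟-diff γ δ with γ Fin.≟ δ | (δ ⊕ (⊖ γ)) Fin.≟ 0ᴰ
  ... | yes _    | yes _      = refl
  ... | no _     | no _       = refl
  ... | yes refl | no γ-γ≢0   = contradiction (x≈y⇒x∙y⁻¹≈ε refl) γ-γ≢0
  ... | no γ≢δ   | yes δ-γ≡0  = contradiction (sym (x∙y⁻¹≈ε⇒x≈y δ γ δ-γ≡0)) γ≢δ

module Orthogonality (D : DiscForm) where
  open DiscForm D

  private
    ≡0⇒∣ : ∀ {x} → x ≡ + 0 [mod M ] → + M ∣ x
    ≡0⇒∣ {x} x≡0 = subst (+ M ∣_) (ℤ.+-identityʳ x) (∣ᵤ⇒∣ x≡0)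

    ∣⇒≡0 : ∀ {x} → + M ∣ x → x ≡ + 0 [mod M ]
    ∣⇒≡0 {x} M∣x = ∣⇒∣ᵤ (subst (+ M ∣_) (sym (ℤ.+-identityʳ x)) M∣x)

  B-sym : ∀ x y → B x y ≡ B y x
  B-sym x y = begin
    Q (x ⊕ y) ℤ.- Q x ℤ.- Q y ≡⟨ cong (λ z → Q z ℤ.- Q x ℤ.- Q y) (⊕-comm x y) ⟩
    Q (y ⊕ x) ℤ.- Q x ℤ.- Q y ≡⟨ ℤ.+-assoc (Q (y ⊕ x)) (ℤ.- Q x) (ℤ.- Q y) ⟩
    Q (y ⊕ x) ℤ.+ (ℤ.- Q x ℤ.- Q y) ≡⟨ cong (λ z → Q (y ⊕ x) ℤ.+ z) (ℤ.+-comm (ℤ.- Q x) (ℤ.- Q y)) ⟩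
    Q (y ⊕ x) ℤ.+ (ℤ.- Q y ℤ.- Q x) ≡⟨ ℤ.+-assoc (Q (y ⊕ x)) (ℤ.- Q y) (ℤ.- Q x) ⟨
    Q (y ⊕ x) ℤ.- Q y ℤ.- Q x ∎
    where open ≡-Reasoning

  Orth-sym : ∀ {x y} → Orth D x y → Orth D y x
  Orth-sym {x} {y} = subst (_≡ + 0 [mod M ]) (B-sym x y)

  Orth-⊕ˡ : ∀ {x y z} → Orth D x z → Orth D y z → Orth D (x ⊕ y) z
  Orth-⊕ˡ {x} {y} {z} x⊥z y⊥z = ∣⇒≡0 {B (x ⊕ y) z} (∣m+n∣n⇒∣m
    (∣ᵤ⇒∣ {i = B (x ⊕ y) z ℤ.- (B x z ℤ.+ B y z)} (B-additiveˡ x y z))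
    (∣m⇒∣-m (∣m∣n⇒∣m+n (≡0⇒∣ {B x z} x⊥z) (≡0⇒∣ {B y z} y⊥z))))

  isotropic⇒Orth : ∀ {K} → IsSubgroup D K → IsIsotropic D K →
                   ∀ {κ κ′} → _∈_ D κ K → _∈_ D κ′ K → Orth D κ κ′
  isotropic⇒Orth (_ , ⊕-closed , _) K-iso {κ} {κ′} κ∈K κ′∈K = ∣⇒≡0 {B κ κ′}
    (∣m∣n⇒∣m-n (∣m∣n⇒∣m-n (≡0⇒∣ {Q (κ ⊕ κ′)} (K-iso _ (⊕-closed κ κ′ κ∈K κ′∈K)))
                           (≡0⇒∣ {Q κ} (K-iso κ κ∈K)))
               (≡0⇒∣ {Q κ′} (K-iso κ′ κ′∈K)))

module Sums (F : CommutativeRing 0ℓ 0ℓ) where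
  open CommutativeRing F renaming (Carrier to C; refl to ≈-refl; sym to ≈-sym; trans to ≈-trans)
  open RingBasics F using (sumFin; fromℕ)

  χ : Bool → C
  χ b = if b then 1# else 0#

  sumFin-cong : ∀ {k} {f g : Fin k → C} → (∀ i → f i ≈ g i) → sumFin f ≈ sumFin g
  sumFin-cong {zero}  f≈g = ≈-refl
  sumFin-cong {suc k} f≈g = +-cong (f≈g Fin.zero) (sumFin-cong (λ i → f≈g (Fin.suc i)))

  *-distribˡ-sumFin : ∀ {k} c (f : Fin k → C) → c * sumFin f ≈ sumFin (λ i → c * f i)
  *-distribˡ-sumFin {zero}  c f = zeroʳ c
  *-distribˡ-sumFin {suc k} c f = ≈-trans (distribˡ c _ _) (+-congˡ (*-distribˡ-sumFin c (λ i → f (Fin.suc i))))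

  sumFin-zero : ∀ {k} {f : Fin k → C} → (∀ i → f i ≈ 0#) → sumFin f ≈ 0#
  sumFin-zero {zero}  f≈0 = ≈-refl
  sumFin-zero {suc k} f≈0 = ≈-trans (+-cong (f≈0 Fin.zero) (sumFin-zero (λ i → f≈0 (Fin.suc i)))) (+-identityˡ 0#)

  sumFin-one : ∀ k → sumFin {k} (λ _ → 1#) ≈ fromℕ k
  sumFin-one zero    = ≈-refl
  sumFin-one (suc k) = +-congˡ (sumFin-one k)

  sumFin-χ-unique : ∀ {k} (f : Fin k → Bool) {i₀} → f i₀ ≡ true → (∀ i → f i ≡ true → i ≡ i₀) →
                    sumFin (λ i → χ (f i)) ≈ 1#
  sumFin-χ-unique f {Fin.zero} fi₀ unique = ≈-trans
    (+-cong (reflexive (≡.cong χ fi₀))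
            (sumFin-zero {f = λ i → χ (f (Fin.suc i))}
                         (λ i → reflexive (≡.cong χ (Bool.¬-not λ fi → Fin.0≢1+n (≡.sym (unique _ fi)))))))
    (+-identityʳ 1#)
  sumFin-χ-unique f {Fin.suc i₀} fi₀ unique = ≈-trans
    (+-cong (reflexive (≡.cong χ (Bool.¬-not λ f0 → Fin.0≢1+n (unique _ f0))))
            (sumFin-χ-unique (λ i → f (Fin.suc i)) fi₀ (λ i fi → Fin.suc-injective (unique _ fi))))
    (+-identityˡ 1#)

module LiftCombinations (D : DiscForm) (F : CommutativeRing 0ℓ 0ℓ) where
  open DiscForm D using (n)
  open CommutativeRing F renaming (Carrier to C; refl to ≈-refl; sym to ≈-sym; trans to ≈-trans)
  open RingBasics F using (sumFin)

  termAt : LiftTerm D F → Fin n → C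
  termAt t δ = LiftTerm.coeff t * lift D F (LiftTerm.K t) (LiftTerm.vec t) δ

  sumList-tabulate-++ : ∀ {k} (f : Fin k → LiftTerm D F) ts δ →
    sumList D F (tabulate f ++ ts) δ ≈ sumFin (λ i → termAt (f i) δ) + sumList D F ts δ
  sumList-tabulate-++ {zero}  f ts δ = ≈-sym (+-identityˡ _)
  sumList-tabulate-++ {suc k} f ts δ = ≈-trans
    (+-congˡ (sumList-tabulate-++ (λ i → f (Fin.suc i)) ts δ))
    (≈-sym (+-assoc _ _ _))

module CosetLift (D : DiscForm) (F : CommutativeRing 0ℓ 0ℓ) {K : Subset D}
  (K-subgroup : IsSubgroup D K) (K-isotropic : IsIsotropic D K)
  {γ : Fin (DiscForm.n D)} (γ∈K⊥ : InPerp D K γ) where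
  open DiscForm D
  open DiscFormGroup D
  open Orthogonality D
  open CommutativeRing F renaming (Carrier to C; refl to ≈-refl; sym to ≈-sym; trans to ≈-trans)
  open Sums F using (χ)

  cosetIndicator : CosetFn D F K
  cosetIndicator = record
    { w   = λ δ → χ (K (δ ⊕ (⊖ γ)))
    ; inv = λ β κ _ κ∈K → reflexive (≡.cong χ
        (≡.trans (≡.cong K (xy∙z≈xz∙y β κ (⊖ γ))) (∈-⊕-invariant K-subgroup _ κ∈K))) }

  coset⊆K⊥ : ∀ {δ} → _∈_ D (δ ⊕ (⊖ γ)) K → InPerp D K δ
  coset⊆K⊥ {δ} δ-γ∈K κ κ∈K = ≡.subst (λ x → Orth D x κ) (//-rightDividesˡ γ δ)
    (Orth-⊕ˡ (isotropic⇒Orth K-subgroup K-isotropic δ-γ∈K κ∈K) (γ∈K⊥ κ κ∈K))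

  lift-cosetIndicator : ∀ δ → lift D F K cosetIndicator δ ≈ χ (K (δ ⊕ (⊖ γ)))
  lift-cosetIndicator δ with inPerp? D K δ
  ... | yes _     = ≈-refl
  ... | no δ∉K⊥ = reflexive (≡.cong χ (≡.sym (Bool.¬-not (δ∉K⊥ ∘ coset⊆K⊥))))

module _ (D : DiscForm) where
  open DiscForm D
  open DiscFormGroup D

  module Lines {m : ℕ} (p-prime : Prime (2+ m)) {H : Subset D} (H-subgroup : IsSubgroup D H)
    {a b : Fin n} (pa≡0 : (2+ m) · a ≡ 0ᴰ) (pb≡0 : (2+ m) · b ≡ 0ᴰ)
    (H-coords : ∀ h → _∈_ D h H ⇔ (∃[ i ] ∃[ j ] (h ≡ (toℕ {2+ m} i · a) ⊕ (toℕ {2+ m} j · b))))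
    (coords-injective : ∀ (i j i′ j′ : Fin (2+ m)) →
       (toℕ i · a) ⊕ (toℕ j · b) ≡ (toℕ i′ · a) ⊕ (toℕ j′ · b) → i ≡ i′ × j ≡ j′) where

    p : ℕ
    p = 2+ m

    coords : Fin p → Fin p → Fin n
    coords i j = (toℕ i · a) ⊕ (toℕ j · b)

    coords∈H : ∀ i j → _∈_ D (coords i j) H
    coords∈H i j = Equivalence.from (H-coords _) (i , j , refl)

    coords≡0⇒ : ∀ i j → coords i j ≡ 0ᴰ → i ≡ Fin.zero × j ≡ Fin.zero
    coords≡0⇒ i j eq = coords-injective i j Fin.zero Fin.zero (trans eq (sym (⊕-idˡ 0ᴰ)))

    line : Fin (suc p) → Fin n
    line Fin.zero    = b
    line (Fin.suc t) = a ⊕ (toℕ t · b)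

    lineCoords : Fin (suc p) → Fin p → Fin p × Fin p
    lineCoords Fin.zero    k = Fin.zero , k
    lineCoords (Fin.suc t) k = k , k *ₘ t

    ·-line : ∀ L k → toℕ k · line L ≡ uncurry coords (lineCoords L k)
    ·-line Fin.zero    k = sym (⊕-idˡ (toℕ k · b))
    ·-line (Fin.suc t) k = begin
      toℕ k · (a ⊕ (toℕ t · b))              ≡⟨ ·-distrib-⊕ a (toℕ t · b) (toℕ k) ⟩
      (toℕ k · a) ⊕ (toℕ k · (toℕ t · b))    ≡⟨ cong ((toℕ k · a) ⊕_) (·-assocˡ b (toℕ k) (toℕ t)) ⟩
      (toℕ k · a) ⊕ ((toℕ k ℕ.* toℕ t) · b)  ≡⟨ cong ((toℕ k · a) ⊕_) (·-mod pb≡0 (toℕ k ℕ.* toℕ t)) ⟩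
      (toℕ k · a) ⊕ (toℕ (k *ₘ t) · b)       ∎
      where open ≡-Reasoning

    line-order : ∀ L → p · line L ≡ 0ᴰ
    line-order Fin.zero    = pb≡0
    line-order (Fin.suc t) = begin
      p · (a ⊕ (toℕ t · b))          ≡⟨ ·-distrib-⊕ a (toℕ t · b) p ⟩
      (p · a) ⊕ (p · (toℕ t · b))    ≡⟨ cong₂ _⊕_ pa≡0 (·-comm b p (toℕ t)) ⟩
      0ᴰ ⊕ (toℕ t · (p · b))         ≡⟨ cong (λ y → 0ᴰ ⊕ (toℕ t · y)) pb≡0 ⟩
      0ᴰ ⊕ (toℕ t · 0ᴰ)              ≡⟨ trans (⊕-idˡ _) (·-zeroʳ (toℕ t)) ⟩
      0ᴰ                             ∎
      where open ≡-Reasoning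

    _∈line_ : Fin n → Fin (suc p) → Set
    x ∈line L = _∈_ D x (cyclic {p} (line L))

    lineCoords∈line : ∀ L k → uncurry coords (lineCoords L k) ∈line L
    lineCoords∈line L k = subst (λ y → _∈_ D y (cyclic (line L))) (·-line L k) (toℕ·∈cyclic (line L) k)

    ∈line⇒lineCoords : ∀ L {x} → x ∈line L → Σ[ k ∈ Fin p ] x ≡ uncurry coords (lineCoords L k)
    ∈line⇒lineCoords L x∈L = let k , kL≡x = ∈cyclic⇒ x∈L in k , trans (sym kL≡x) (·-line L k)

    line⊆H : ∀ L {x} → x ∈line L → _∈_ D x H
    line⊆H L x∈L = let k , x≡ = ∈line⇒lineCoords L x∈L in
      subst (λ y → _∈_ D y H) (sym x≡) (uncurry coords∈H (lineCoords L k))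

    1ₚ : Fin p
    1ₚ = Fin.suc Fin.zero

    line≡coords : ∀ L → line L ≡ uncurry coords (lineCoords L 1ₚ)
    line≡coords L = trans (sym (identityʳ (line L))) (·-line L 1ₚ)

    line≢0 : ∀ L → line L ≢ 0ᴰ
    line≢0 Fin.zero    b≡0    =
      Fin.0≢1+n (sym (proj₂ (coords≡0⇒ Fin.zero 1ₚ (trans (sym (line≡coords Fin.zero)) b≡0))))
    line≢0 (Fin.suc t) line≡0 =
      Fin.0≢1+n (sym (proj₁ (coords≡0⇒ 1ₚ (1ₚ *ₘ t) (trans (sym (line≡coords (Fin.suc t))) line≡0))))

    ∃!-line : ∀ {x} → _∈_ D x H → x ≢ 0ᴰ →
              Σ[ L ∈ Fin (suc p) ] (x ∈line L × ∀ L′ → x ∈line L′ → L′ ≡ L)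
    ∃!-line x∈H x≢0 with Equivalence.to (H-coords _) x∈H
    ... | u , v , refl with u Fin.≟ Fin.zero
    ...   | yes refl = Fin.zero , lineCoords∈line Fin.zero v , only-b
      where
      only-b : ∀ L′ → coords Fin.zero v ∈line L′ → L′ ≡ Fin.zero
      only-b Fin.zero     _    = refl
      only-b (Fin.suc t′) x∈L′
        with k , eq ← ∈line⇒lineCoords (Fin.suc t′) x∈L′
        with refl , refl ← coords-injective Fin.zero v k (k *ₘ t′) eq
        = contradiction (⊕-idˡ 0ᴰ) x≢0
    ...   | no u≢0 = Fin.suc t , x∈lineₜ , only-t
      where
      u*ₘ-injective : Injective _≡_ _≡_ (u *ₘ_)
      u*ₘ-injective = *ₘ-cancelˡ p-prime (u≢0 ∘ Fin.toℕ-injective)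
      t : Fin p
      t = proj₁ (injective⇒surjective u*ₘ-injective v)
      ut≡v : u *ₘ t ≡ v
      ut≡v = proj₂ (injective⇒surjective u*ₘ-injective v)
      x∈lineₜ : coords u v ∈line Fin.suc t
      x∈lineₜ = subst (λ j → coords u j ∈line Fin.suc t) ut≡v (lineCoords∈line (Fin.suc t) u)
      only-t : ∀ L′ → coords u v ∈line L′ → L′ ≡ Fin.suc t
      only-t L′ x∈L′ with k , eq ← ∈line⇒lineCoords L′ x∈L′ | L′
      ... | Fin.zero     = contradiction (proj₁ (coords-injective u v Fin.zero k eq)) u≢0
      ... | Fin.suc t′ with refl , v≡ut′ ← coords-injective u v k (k *ₘ t′) eq =
        cong Fin.suc (u*ₘ-injective (trans (sym v≡ut′) (sym ut≡v)))

    module _ (F : CommutativeRing 0ℓ 0ℓ) where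
      open CommutativeRing F
        using (_≈_; _+_; _*_; 0#; 1#; +-identityʳ; *-identityʳ; zeroʳ; +-cong; +-congˡ; reflexive)
        renaming (sym to ≈-sym; trans to ≈-trans)
      open RingBasics F using (sumFin; fromℕ)
      open Sums F

      lines-through : ∀ x →
        sumFin (λ L → χ (cyclic {p} (line L) x)) ≈ χ (H x) + fromℕ p * χ ⌊ x Fin.≟ 0ᴰ ⌋
      lines-through x with x Fin.≟ 0ᴰ
      ... | yes refl = ≈-trans
        (≈-trans (sumFin-cong {f = λ L → χ (cyclic (line L) 0ᴰ)} λ L →
                    reflexive (cong χ (toℕ·∈cyclic {p} (line L) Fin.zero)))
                 (sumFin-one (suc p)))
        (+-cong (reflexive (cong χ (sym (proj₁ H-subgroup)))) (≈-sym (*-identityʳ (fromℕ p))))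
      ... | no x≢0 with H x in x∈?H
      ...   | true  = let L , x∈L , unique = ∃!-line x∈?H x≢0 in ≈-trans
        (sumFin-χ-unique (λ L → cyclic (line L) x) x∈L unique)
        (≈-sym (≈-trans (+-congˡ (zeroʳ (fromℕ p))) (+-identityʳ 1#)))
      ...   | false = ≈-trans
        (sumFin-zero λ L → reflexive (cong χ (Bool.¬-not λ x∈L →
           contradiction (trans (sym x∈?H) (line⊆H L x∈L)) λ ())))
        (≈-sym (≈-trans (+-congˡ (zeroʳ (fromℕ p))) (+-identityʳ 0#)))

module PlaneLifts (F : CommutativeRing 0ℓ 0ℓ) (F-field : IsFieldChar0 F) (D : DiscForm)
  {m : ℕ} (p-prime : Prime (2+ m)) (γ : Fin (DiscForm.n D))
  {H : Subset D} (H-subgroup : IsSubgroup D H) (H-isotropic : IsIsotropic D H)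
  (H⊥γ : ∀ h → _∈_ D h H → Orth D h γ) where
  open DiscForm D
  open DiscFormGroup D
  open Orthogonality D
  open CommutativeRing F renaming (Carrier to C; refl to ≈-refl; sym to ≈-sym; trans to ≈-trans)
  open RingBasics F using (sumFin; fromℕ)
  open Sums F
  open LiftCombinations D F

  _⊆H : Subset D → Set
  K ⊆H = ∀ {x} → _∈_ D x K → _∈_ D x H

  ⊆H⇒isotropic : ∀ {K} → K ⊆H → IsIsotropic D K
  ⊆H⇒isotropic K⊆H x = H-isotropic x ∘ K⊆H

  ⊆H⇒γ∈⊥ : ∀ {K} → K ⊆H → InPerp D K γ
  ⊆H⇒γ∈⊥ K⊆H κ = Orth-sym ∘ H⊥γ κ ∘ K⊆H

  subgroupTerm : (K : Subset D) → IsSubgroup D K → K ⊆H → NonTrivial D K → C → LiftTerm D F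
  subgroupTerm K K-subgroup K⊆H K-nontrivial c = record
    { K = K ; K-sub = K-subgroup ; K-iso = ⊆H⇒isotropic K⊆H ; K-nt = K-nontrivial ; coeff = c
    ; vec = CosetLift.cosetIndicator D F K-subgroup (⊆H⇒isotropic K⊆H) (⊆H⇒γ∈⊥ K⊆H) }

  termAt-subgroupTerm : ∀ K (K-subgroup : IsSubgroup D K) (K⊆H : K ⊆H) K-nontrivial c δ →
    termAt (subgroupTerm K K-subgroup K⊆H K-nontrivial c) δ ≈ c * χ (K (δ ⊕ (⊖ γ)))
  termAt-subgroupTerm K K-subgroup K⊆H _ c δ =
    *-congˡ (CosetLift.lift-cosetIndicator D F K-subgroup (⊆H⇒isotropic K⊆H) (⊆H⇒γ∈⊥ K⊆H) δ)

  basis∈liftSpan : IsoZp² D (2+ m) H → InLiftSpan D F (basis D F γ)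
  basis∈liftSpan (_ , _ , pa≡0 , pb≡0 , H-coords , coords-injective) = terms , basis≈sumList
    where
    open Lines D p-prime H-subgroup pa≡0 pb≡0 H-coords coords-injective

    p≉0 : ¬ (fromℕ p ≈ 0#)
    p≉0 = proj₂ (proj₂ F-field) (suc m)

    p⁻¹ : C
    p⁻¹ = proj₁ (proj₁ (proj₂ F-field) (fromℕ p) p≉0)

    p⁻¹*p≈1 : p⁻¹ * fromℕ p ≈ 1#
    p⁻¹*p≈1 = ≈-trans (*-comm p⁻¹ (fromℕ p)) (proj₂ (proj₁ (proj₂ F-field) (fromℕ p) p≉0))

    line-nontrivial : ∀ L → NonTrivial D (cyclic {p} (line L))
    line-nontrivial L = line L , generator∈cyclic {p} (line-order L) , line≢0 L

    lineTerm : Fin (suc p) → LiftTerm D F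
    lineTerm L =
      subgroupTerm (cyclic {p} (line L)) (cyclic-isSubgroup (line-order L)) (line⊆H L) (line-nontrivial L) p⁻¹

    H-nontrivial : NonTrivial D H
    H-nontrivial = let g , g∈L , g≢0 = line-nontrivial Fin.zero in g , line⊆H Fin.zero g∈L , g≢0

    planeTerm : LiftTerm D F
    planeTerm = subgroupTerm H H-subgroup id H-nontrivial (- p⁻¹)

    terms : List (LiftTerm D F)
    terms = tabulate lineTerm ++ planeTerm ∷ []

    basis≈sumList : ∀ δ → basis D F γ δ ≈ sumList D F terms δ
    basis≈sumList δ = begin
      basis D F γ δ
        ≡⟨ ≡.cong χ (≟-diff γ δ) ⟩
      χ isZero
        ≈⟨ ≈-sym (x[y+zw]+[-x]y≈w F p⁻¹*p≈1 (χ (H x)) (χ isZero)) ⟩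
      p⁻¹ * (χ (H x) + fromℕ p * χ isZero) + (- p⁻¹) * χ (H x)
        ≈⟨ +-congʳ (*-congˡ (≈-sym (lines-through F x))) ⟩
      p⁻¹ * sumFin (λ L → χ (cyclic {p} (line L) x)) + (- p⁻¹) * χ (H x)
        ≈⟨ +-cong (*-distribˡ-sumFin p⁻¹ (λ L → χ (cyclic {p} (line L) x))) (≈-sym (+-identityʳ _)) ⟩
      sumFin (λ L → p⁻¹ * χ (cyclic {p} (line L) x)) + ((- p⁻¹) * χ (H x) + 0#)
        ≈⟨ +-cong (sumFin-cong λ L → ≈-sym (termAt-lineTerm L))
                  (+-congʳ (≈-sym (termAt-subgroupTerm H H-subgroup id H-nontrivial (- p⁻¹) δ))) ⟩
      sumFin (λ L → termAt (lineTerm L) δ) + (termAt planeTerm δ + 0#)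
        ≈⟨ ≈-sym (sumList-tabulate-++ lineTerm (planeTerm ∷ []) δ) ⟩
      sumList D F terms δ
        ∎
      where
      open SetoidReasoning setoid
      x : Fin n
      x = δ ⊕ (⊖ γ)
      termAt-lineTerm : ∀ L → termAt (lineTerm L) δ ≈ p⁻¹ * χ (cyclic {p} (line L) x)
      termAt-lineTerm L = termAt-subgroupTerm (cyclic (line L)) (cyclic-isSubgroup (line-order L))
                            (line⊆H L) (line-nontrivial L) p⁻¹ δ
      isZero : Bool
      isZero = ⌊ x Fin.≟ 0ᴰ ⌋

proposition7p1 : (F : CommutativeRing 0ℓ 0ℓ) → IsFieldChar0 F →
    (D : DiscForm) → (ζ : CommutativeRing.Carrier F) → IsPrimitiveRoot D F ζ →
    (p l : ℕ) → Prime p → IsLevel D (p ^ l) → EvenSignature D F ζ →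
    (γ : Fin (DiscForm.n D)) →
    (H : Subset D) → IsSubgroup D H → IsIsotropic D H →
    (∀ h → _∈_ D h H → Orth D h γ) → IsoZp² D p H →
    InLiftSpan D F (basis D F γ)
proposition7p1 F _ D _ _ 0        _ 0-prime _ _ _ _ _ _ _ _ = contradiction 0-prime ¬prime[0]
proposition7p1 F _ D _ _ 1        _ 1-prime _ _ _ _ _ _ _ _ = contradiction 1-prime ¬prime[1]
proposition7p1 F F-field D _ _ (2+ m) _ p-prime _ _ γ H H-subgroup H-isotropic H⊥γ H≅Zp² =
  PlaneLifts.basis∈liftSpan F F-field D p-prime γ H-subgroup H-isotropic H⊥γ H≅Zp²
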